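{- Let $\mathcal{D}=(\mathrm{Col},\mathrm{T},\text{white})$ be a domino tiling system satisfying: - the all-white tile belongs to $\mathrm{T}$; - every other tile of $\mathrm{T}$ containing white is both left- and up-border but neither down- nor right-border. Then: - for every proper $\mathrm{T}$-hyperoctant $\mathcal{I}$, the map $\xi:\mathbb{O}\to\mathrm{T}$ represented by $\mathcal{I}$ witnesses that $\mathcal{D}$ covers the octant; - if $\mathcal{D}$ covers the octant, as witnessed by $\xi:\mathbb{O}\to\mathrm{T}$, then there exists a proper $\mathrm{T}$-hyperoctant representing $\xi$.
   Context: Tiles are quadruples $(c_l,c_d,c_r,c_u)$ of colours. A tile is left-, down-, right-, or up-border if $c_l$, $c_d$, $c_r$, or $c_u$ respectively equals white. Tiles $t=(c_l,c_d,c_r,c_u)$ and $t'=(c_l',c_d',c_r',c_u')$ are H-compatible if $c_r=c_l'$, and V-compatible if $c_u=c_d'$. The octant is $\mathbb{O}=\{(n,m)\in\mathbb{N}^2\mid m\le n\}$. $\mathcal{D}$ covers the octant via $\xi:\mathbb{O}\to\mathrm{T}$ if: - (OInit) $\xi(0,0)$ is the all-white tile and $\xi(1,0)$ is not; - (OVerti) $\xi(n,m),\xi(n,m+1)$ are V-compatible whenever $(n,m+1)\in\mathbb{O}$; - (OHori) $\xi(n,m),\xi(n+1,m)$ are H-compatible for all $(n,m)\in\mathbb{O}$. Enumerate $\mathrm{T}=\{t_1,\dots,t_N\}$ with $N=|\mathrm{T}|$, and let $\mathbb{Z}_k=\{0,\dots,k-1\}$. Fix role names $r,s$, concept names $C_t$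 ($t\in\mathrm{T}$), and concept names $\mathrm{In},\overline{\mathrm{In}},\mathrm{Cur},\mathrm{Prev},\overline{\mathrm{Prev}}$. A $\mathrm{T}$-octant is an interpretation with domain $\mathbb{O}$ such that, for some $\xi:\mathbb{O}\to\mathrm{T}$ satisfying (OInit) and (OVerti) (the octant represents $\xi$): - $r$ is interpreted as $\{((n,0),(n+1,0))\mid n\in\mathbb{N}\}$; - $s$ is interpreted as $\{((n,m),(n,m+1))\mid m<n\}$; - $C_t$ is interpreted as $\{(n,m)\mid\xi(n,m)=t\}$. A $\mathrm{T}$-hyperoctant is an interpretation $\mathcal{I}$ with domain $(\mathbb{O}\times\mathbb{Z}_{N+1})\cup\{(-i-1,0,0)\mid i\in\mathbb{Z}_N\}$ such that: - the restriction $\mathcal{I}_{\mathbb{O}}$ of $\mathcal{I}$ to $\mathbb{O}\times\{0\}$ is isomorphic, via $(n,m,0)\mapsto(n,m)$ and with respect to $r$, $s$ and the $C_t$, to a $\mathrm{T}$-octant; - $\mathrm{In}^{\mathcal{I}}=\mathbb{O}\times\{0\}$, $\overline{\mathrm{In}}^{\mathcal{I}}=\Delta^{\mathcal{I}}\setminus\mathrm{In}^{\mathcal{I}}$, and $\overline{\mathrm{Prev}}^{\mathcal{I}}=\Delta^{\mathcal{I}}\setminus\mathrm{Prev}^{\mathcal{I}}$; - $r^{\mathcal{I}}=r^{\mathcal{I}_{\mathbb{O}}}\cup\{((-i-1,0,0),(-i,0,0))\mid i\in\mathbb{Z}_N\}$; - $s^{\mathcal{I}}=s^{\mathcal{I}_{\mathbb{O}}}\cup\{((n,m,k),(n,m,k+1))\mid(n,m)\in\mathbb{O},k\in\mathbb{Z}_N\}$;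 - $C_{t_k}^{\mathcal{I}}=C_{t_k}^{\mathcal{I}_{\mathbb{O}}}$, and $\mathrm{Cur}^{\mathcal{I}}=\{(n,m,k)\mid(n,m,0)\in C_{t_k}^{\mathcal{I}},\ 1\le k\le N\}$; - for every $(n,m)\in\mathbb{O}$ there is exactly one positive $k$ with $(n,m,k)\in\mathrm{Prev}^{\mathcal{I}}$, and for this $k$ the tiles $t_k$ and the tile carried by $(n,m,0)$ are H-compatible (in this order). A hyperoctant $\mathcal{I}$ is proper if $(n,m,k)\in\mathrm{Cur}^{\mathcal{I}}$ implies $(n+1,m,k)\in\mathrm{Prev}^{\mathcal{I}}$. The map represented by $\mathcal{I}$ is the map represented by the $\mathrm{T}$-octant $\mathcal{I}_{\mathbb{O}}$. -}

module Defs where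

open import Data.Nat using (ℕ; zero; suc; _≤_; _<_)
open import Data.Nat.Properties using (m≤n⇒m≤1+n)
open import Data.Fin using (Fin; zero; suc; inject₁; toℕ)
open import Data.Product using (Σ; Σ-syntax; ∃; ∃-syntax; _×_; _,_)
open import Data.Sum using (_⊎_)
open import Data.Unit using (⊤)
open import Data.Empty using (⊥)
open import Relation.Nullary using (¬_)
open import Relation.Binary.PropositionalEquality using (_≡_; _≢_)
open import Function.Bundles using (_⇔_)
open import Level using (0ℓ)

record Tile (nc : ℕ) : Set where
  constructor tile
  field
    cl cd cr cu : Fin nc
open Tile public

allWhite : ∀ {nc} → Fin nc → Tile nc
allWhite w = tile w w w w

-- The tile set T = {t_1,…,t_N} is given by its enumeration
-- tiles : Fin N → Tile nc  (index i : Fin N stands for t_{i+1}).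

HCompat : ∀ {nc} → Tile nc → Tile nc → Set
HCompat t t' = cr t ≡ cl t'

VCompat : ∀ {nc} → Tile nc → Tile nc → Set
VCompat t t' = cu t ≡ cd t'

ContainsWhite : ∀ {nc} → Fin nc → Tile nc → Set
ContainsWhite w t = (cl t ≡ w) ⊎ (cd t ≡ w) ⊎ (cr t ≡ w) ⊎ (cu t ≡ w)

AllWhiteIn : ∀ {nc N} → Fin nc → (Fin N → Tile nc) → Set
AllWhiteIn w tiles = ∃[ k ] tiles k ≡ allWhite w

OtherWhiteBorder : ∀ {nc N} → Fin nc → (Fin N → Tile nc) → Set
OtherWhiteBorder w tiles =
  ∀ k → ContainsWhite w (tiles k) → tiles k ≢ allWhite w →
    (cl (tiles k) ≡ w) × (cu (tiles k) ≡ w) × (cd (tiles k) ≢ w) × (cr (tiles k) ≢ w)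

record Pt : Set where
  constructor pt
  field
    n m : ℕ
    .le : m ≤ n
open Pt public

origin : Pt
origin = pt 0 0 Data.Nat.z≤n

one0 : Pt
one0 = pt 1 0 Data.Nat.z≤n

right : Pt → Pt
right (pt a b h) = pt (suc a) b (m≤n⇒m≤1+n h)

OInit : ∀ {nc N} → Fin nc → (Fin N → Tile nc) → (Pt → Fin N) → Set
OInit w tiles ξ = (tiles (ξ origin) ≡ allWhite w) × (tiles (ξ one0) ≢ allWhite w)

OVerti : ∀ {nc N} → (Fin N → Tile nc) → (Pt → Fin N) → Set
OVerti tiles ξ = ∀ a b → (h : suc b ≤ a) →
  VCompat (tiles (ξ (pt a b (m≤n⇒m≤1+n' h)))) (tiles (ξ (pt a (suc b) h)))
  where
  m≤n⇒m≤1+n' : ∀ {x y} → suc x ≤ y → x ≤ y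
  m≤n⇒m≤1+n' (Data.Nat.s≤s q) = m≤n⇒m≤1+n q

OHori : ∀ {nc N} → (Fin N → Tile nc) → (Pt → Fin N) → Set
OHori tiles ξ = ∀ p → HCompat (tiles (ξ p)) (tiles (ξ (right p)))

Covers : ∀ {nc N} → Fin nc → (Fin N → Tile nc) → (Pt → Fin N) → Set
Covers w tiles ξ = OInit w tiles ξ × OVerti tiles ξ × OHori tiles ξ

-- Interpretations (concepts/roles as predicates/relations on a domain)

record OInterp (Δ : Set) (N : ℕ) : Set₁ where
  field
    r s : Δ → Δ → Set
    C   : Fin N → Δ → Set

record Interp (Δ : Set) (N : ℕ) : Set₁ where
  field
    r s : Δ → Δ → Set
    C   : Fin N → Δ → Set
    In InBar Cur Prev PrevBar : Δ → Set

IsTOctantFor : ∀ {N} → (Pt → Fin N) → OInterp Pt N → Set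
IsTOctantFor ξ J =
    (∀ p q → OInterp.r J p q ⇔ ((m p ≡ 0) × (m q ≡ 0) × (n q ≡ suc (n p))))
  × (∀ p q → OInterp.s J p q ⇔ ((n q ≡ n p) × (m q ≡ suc (m p))))
  × (∀ k p → OInterp.C J k p ⇔ (ξ p ≡ k))

IsTOctant : ∀ {nc N} → Fin nc → (Fin N → Tile nc) → OInterp Pt N → Set
IsTOctant w tiles J =
  ∃[ ξ ] (OInit w tiles ξ × OVerti tiles ξ × IsTOctantFor ξ J)

data HDom (N : ℕ) : Set where
  inO : Pt → Fin (suc N) → HDom N
  neg : Fin N → HDom N      -- neg i  represents (-i-1,0,0)

Layer0 : ∀ {N} → HDom N → Set
Layer0 (inO _ zero)    = ⊤
Layer0 (inO _ (suc _)) = ⊥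
Layer0 (neg _)         = ⊥

negSucc : ∀ {N} → Fin N → HDom N
negSucc zero    = inO origin zero
negSucc (suc i) = neg (inject₁ i)

NegEdge : ∀ {N} → HDom N → HDom N → Set
NegEdge (neg i) y   = y ≡ negSucc i
NegEdge (inO _ _) _ = ⊥

UpEdge : ∀ {N} → HDom N → HDom N → Set
UpEdge (inO p k) (inO q k') = (p ≡ q) × (toℕ k' ≡ suc (toℕ k))
UpEdge (inO _ _) (neg _)    = ⊥
UpEdge (neg _)   _          = ⊥

restrict : ∀ {N} → Interp (HDom N) N → OInterp Pt N
restrict I = record
  { r = λ p q → Interp.r I (inO p zero) (inO q zero)
  ; s = λ p q → Interp.s I (inO p zero) (inO q zero)
  ; C = λ k p → Interp.C I k (inO p zero)
  }

CurSet : ∀ {N} → Interp (HDom N) N → HDom N → Set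
CurSet I (inO p zero)    = ⊥
CurSet I (inO p (suc j)) = Interp.C I j (inO p zero)
CurSet I (neg _)         = ⊥

IsHyperoctant : ∀ {nc N} → Fin nc → (Fin N → Tile nc) → Interp (HDom N) N → Set
IsHyperoctant w tiles I =
    IsTOctant w tiles (restrict I)
  × (∀ x → In x ⇔ Layer0 x)
  × (∀ x → InBar x ⇔ (¬ In x))
  × (∀ x → PrevBar x ⇔ (¬ Prev x))
  × (∀ x y → r x y ⇔ ((Layer0 x × Layer0 y × r x y) ⊎ NegEdge x y))
  × (∀ x y → s x y ⇔ ((Layer0 x × Layer0 y × s x y) ⊎ UpEdge x y))
  -- C_{t_k}^I = C_{t_k}^{I_O}
  × (∀ k x → C k x → Layer0 x)
  × (∀ x → Cur x ⇔ CurSet I x)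
  × (∀ p → ∃[ j ] (Prev (inO p (suc j))
                   × (∀ j' → Prev (inO p (suc j')) → j' ≡ j)
                   × (∀ k → C k (inO p zero) → HCompat (tiles j) (tiles k))))
  where open Interp I

Proper : ∀ {N} → Interp (HDom N) N → Set
Proper I = ∀ p k → Interp.Cur I (inO p k) → Interp.Prev I (inO (right p) k)

Represents : ∀ {N} → (Pt → Fin N) → Interp (HDom N) N → Set
Represents ξ I = IsTOctantFor ξ (restrict I)

{-# OPTIONS --safe #-}
-- A proper hyperoctant carries the index of the tile at p in Cur above p;
-- properness pushes it into Prev above the right neighbour of p, where Prev is
-- unique and H-compatible with that neighbour's tile, which is exactly (OHori).
-- Conversely, given a cover ξ, fill Prev above p with the tile to the left of p.
-- Only the origin and the diagonal lack a left neighbour, and the border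
-- conditions make the whole diagonal white: if (a,a) is white, then (a+1,a) has
-- white left colour, hence white up colour, so (a+1,a+1) has white down colour,
-- which only the all-white tile has. There the all-white tile is a compatible
-- Prev entry.
module Submission where

open import Defs
open import Data.Nat using (ℕ; zero; suc; _≤?_)
open import Data.Nat.Properties using (≤-refl; n≤1+n; n≤0⇒n≡0; ≤-antisym; ≰⇒>)
open import Data.Fin using (Fin; zero; suc; _≟_)
open import Data.Product using (Σ-syntax; _×_; _,_; proj₁; proj₂)
open import Data.Sum using (_⊎_; inj₁; inj₂)
open import Data.Unit using (tt)
open import Data.Empty using (⊥; ⊥-elim)
open import Relation.Nullary using (¬_; Dec; yes; no)
open import Relation.Nullary.Decidable using (recompute)
open import Relation.Binary.PropositionalEquality using (_≡_; _≢_; refl; sym; trans; cong; subst)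
open import Function.Definitions using (Injective)
open import Function.Bundles using (_⇔_; mk⇔; Equivalence)
open import Function.Construct.Identity using (⇔-id)

open Equivalence using (to; from)

representation-unique : ∀ {N} {J : OInterp Pt N} {ξ ξ′ : Pt → Fin N} →
  IsTOctantFor ξ J → IsTOctantFor ξ′ J → ∀ p → ξ p ≡ ξ′ p
representation-unique {ξ = ξ} (_ , _ , C⇔ξ) (_ , _ , C⇔ξ′) p =
  sym (to (C⇔ξ′ (ξ p) p) (from (C⇔ξ (ξ p) p) refl))

module _ {nc N : ℕ} {white : Fin nc} {tiles : Fin N → Tile nc} where

  OInit-cong : ∀ {ξ ξ′ : Pt → Fin N} → (∀ p → ξ p ≡ ξ′ p) →
    OInit white tiles ξ → OInit white tiles ξ′
  OInit-cong ξ≗ξ′ (origin-white , one0-not-white) =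
      subst (λ k → tiles k ≡ allWhite white) (ξ≗ξ′ origin) origin-white
    , subst (λ k → tiles k ≢ allWhite white) (ξ≗ξ′ one0) one0-not-white

  OVerti-cong : ∀ {ξ ξ′ : Pt → Fin N} → (∀ p → ξ p ≡ ξ′ p) →
    OVerti tiles ξ → OVerti tiles ξ′
  OVerti-cong ξ≗ξ′ verti a b h =
    trans (cong (λ k → cu (tiles k)) (sym (ξ≗ξ′ _)))
      (trans (verti a b h) (cong (λ k → cd (tiles k)) (ξ≗ξ′ _)))

  proper-hyperoctant-OHori : ∀ {I : Interp (HDom N) N} {ξ : Pt → Fin N} →
    IsHyperoctant white tiles I → Proper I → Represents ξ I → OHori tiles ξ
  proper-hyperoctant-OHori {I} {ξ} (_ , _ , _ , _ , _ , _ , _ , cur⇔ , prev) proper (_ , _ , C⇔ξ) p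
    with prev (right p)
  ... | j , _ , prev-unique , prev-compatible =
    subst (λ k → HCompat (tiles k) (tiles (ξ (right p)))) (sym ξp≡j)
      (prev-compatible (ξ (right p)) (C-at (right p)))
    where
    C-at : ∀ q → Interp.C I (ξ q) (inO q zero)
    C-at q = from (C⇔ξ (ξ q) q) refl

    ξp≡j : ξ p ≡ j
    ξp≡j = prev-unique (ξ p) (proper p (suc (ξ p)) (from (cur⇔ (inO p (suc (ξ p)))) (C-at p)))

  proper-hyperoctant-covers : ∀ {I : Interp (HDom N) N} {ξ : Pt → Fin N} →
    IsHyperoctant white tiles I → Proper I → Represents ξ I → Covers white tiles ξ
  proper-hyperoctant-covers {ξ = ξ} hyp@((ξ′ , init , verti , octant) , _) proper rep =
      OInit-cong ξ′≗ξ init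
    , OVerti-cong ξ′≗ξ verti
    , proper-hyperoctant-OHori hyp proper rep
    where
    ξ′≗ξ : ∀ p → ξ′ p ≡ ξ p
    ξ′≗ξ = representation-unique octant rep

OnPoints : ∀ {N} → (Pt → Pt → Set) → HDom N → HDom N → Set
OnPoints R (inO p _) (inO q _) = R p q
OnPoints R _         _         = ⊥

-- IsHyperoctant asks r and s to be fixed points of LayeredUnion _ E
-- (see LayeredUnion-idem).
LayeredUnion : ∀ {N} → (HDom N → HDom N → Set) → (HDom N → HDom N → Set) → HDom N → HDom N → Set
LayeredUnion Q E x y = (Layer0 x × Layer0 y × Q x y) ⊎ E x y

LayeredUnion-idem : ∀ {N} {Q E : HDom N → HDom N → Set} x y →
  LayeredUnion Q E x y ⇔ LayeredUnion (LayeredUnion Q E) E x y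
LayeredUnion-idem x y = mk⇔
  (λ { (inj₁ (x₀ , y₀ , q)) → inj₁ (x₀ , y₀ , inj₁ (x₀ , y₀ , q)) ; (inj₂ e) → inj₂ e })
  (λ { (inj₁ (_ , _ , u)) → u ; (inj₂ e) → inj₂ e })

module _ {N : ℕ} (ξ prev : Pt → Fin N) where

  C-of : Fin N → HDom N → Set
  C-of k (inO p zero)    = ξ p ≡ k
  C-of k (inO p (suc _)) = ⊥
  C-of k (neg _)         = ⊥

  Cur-of : HDom N → Set
  Cur-of (inO p zero)    = ⊥
  Cur-of (inO p (suc j)) = ξ p ≡ j
  Cur-of (neg _)         = ⊥

  Prev-of : HDom N → Set
  Prev-of (inO p zero)    = ⊥
  Prev-of (inO p (suc j)) = prev p ≡ j
  Prev-of (neg _)         = ⊥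

  hyperoctantWith : Interp (HDom N) N
  hyperoctantWith = record
    { r       = LayeredUnion (OnPoints λ p q → (m p ≡ 0) × (m q ≡ 0) × (n q ≡ suc (n p))) NegEdge
    ; s       = LayeredUnion (OnPoints λ p q → (n q ≡ n p) × (m q ≡ suc (m p))) UpEdge
    ; C       = C-of
    ; In      = Layer0
    ; InBar   = λ x → ¬ Layer0 x
    ; Cur     = Cur-of
    ; Prev    = Prev-of
    ; PrevBar = λ x → ¬ Prev-of x
    }

  hyperoctantWith-represents : Represents ξ hyperoctantWith
  hyperoctantWith-represents =
      (λ p q → mk⇔ (λ { (inj₁ (_ , _ , e)) → e ; (inj₂ ()) }) (λ e → inj₁ (tt , tt , e)))
    , (λ p q → mk⇔ (λ { (inj₁ (_ , _ , e)) → e ; (inj₂ ()) }) (λ e → inj₁ (tt , tt , e)))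
    , (λ k p → ⇔-id _)

  hyperoctantWith-proper : (∀ p → prev (right p) ≡ ξ p) → Proper hyperoctantWith
  hyperoctantWith-proper prev∘right≗ξ p (suc j) ξp≡j = trans (prev∘right≗ξ p) ξp≡j

  hyperoctantWith-isHyperoctant : ∀ {nc} {white : Fin nc} {tiles : Fin N → Tile nc} →
    OInit white tiles ξ → OVerti tiles ξ →
    (∀ p → HCompat (tiles (prev p)) (tiles (ξ p))) →
    IsHyperoctant white tiles hyperoctantWith
  hyperoctantWith-isHyperoctant {tiles = tiles} init verti prev-compatible =
      (ξ , init , verti , hyperoctantWith-represents)
    , (λ x → ⇔-id _) , (λ x → ⇔-id _) , (λ x → ⇔-id _)
    , LayeredUnion-idem , LayeredUnion-idem
    , C-in-layer0 , Cur⇔CurSet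
    , λ p → prev p , refl , (λ j e → sym e)
          , λ { k refl → prev-compatible p }
    where
    C-in-layer0 : ∀ k x → C-of k x → Layer0 x
    C-in-layer0 k (inO p zero) _ = tt

    Cur⇔CurSet : ∀ x → Cur-of x ⇔ CurSet hyperoctantWith x
    Cur⇔CurSet (inO p zero)    = ⇔-id _
    Cur⇔CurSet (inO p (suc j)) = ⇔-id _
    Cur⇔CurSet (neg _)         = ⇔-id _

module BorderSystem {nc N : ℕ} {white : Fin nc} {tiles : Fin N → Tile nc}
  (tiles-injective : Injective _≡_ _≡_ tiles)
  (all-white-in : AllWhiteIn white tiles)
  (other-white-border : OtherWhiteBorder white tiles) where

  w₀ : Fin N
  w₀ = proj₁ all-white-in

  w₀-allWhite : tiles w₀ ≡ allWhite white
  w₀-allWhite = proj₂ all-white-in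

  allWhite? : ∀ k → Dec (tiles k ≡ allWhite white)
  allWhite? k with k ≟ w₀
  ... | yes refl = yes w₀-allWhite
  ... | no k≢w₀  = no λ e → k≢w₀ (tiles-injective (trans e (sym w₀-allWhite)))

  white-left⇒white-up : ∀ k → cl (tiles k) ≡ white → cu (tiles k) ≡ white
  white-left⇒white-up k cl≡white with allWhite? k
  ... | yes e = cong cu e
  ... | no ¬e = proj₁ (proj₂ (other-white-border k (inj₁ cl≡white) ¬e))

  white-down⇒allWhite : ∀ k → cd (tiles k) ≡ white → tiles k ≡ allWhite white
  white-down⇒allWhite k cd≡white with allWhite? k
  ... | yes e = e
  ... | no ¬e = ⊥-elim (proj₁ (proj₂ (proj₂ (other-white-border k (inj₂ (inj₁ cd≡white)) ¬e))) cd≡white)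

  w₀-compatible-allWhite : ∀ {t} → t ≡ allWhite white → HCompat (tiles w₀) t
  w₀-compatible-allWhite t≡allWhite = trans (cong cr w₀-allWhite) (sym (cong cl t≡allWhite))

  module Cover {ξ : Pt → Fin N} (init : OInit white tiles ξ) (verti : OVerti tiles ξ) (hori : OHori tiles ξ) where

    diagonal-allWhite : ∀ a → tiles (ξ (pt a a ≤-refl)) ≡ allWhite white
    diagonal-allWhite zero    = proj₁ init
    diagonal-allWhite (suc a) =
      white-down⇒allWhite _ (trans (sym (verti (suc a) a ≤-refl)) (white-left⇒white-up _ below-cl))
      where
      below-cl : cl (tiles (ξ (pt (suc a) a (n≤1+n a)))) ≡ white
      below-cl = trans (sym (hori (pt a a ≤-refl))) (cong cr (diagonal-allWhite a))

    leftNeighbour : Pt → Fin N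
    leftNeighbour (pt zero    _ _) = w₀
    leftNeighbour (pt (suc a) b _) with b ≤? a
    ... | yes b≤a = ξ (pt a b b≤a)
    ... | no  _   = w₀

    leftNeighbour-right : ∀ p → leftNeighbour (right p) ≡ ξ p
    leftNeighbour-right (pt a b h) with b ≤? a
    ... | yes _   = refl
    ... | no  b≰a = ⊥-elim (b≰a (recompute (b ≤? a) h))

    leftNeighbour-compatible : ∀ p → HCompat (tiles (leftNeighbour p)) (tiles (ξ p))
    leftNeighbour-compatible (pt zero b h) with n≤0⇒n≡0 (recompute (b ≤? zero) h)
    ... | refl = w₀-compatible-allWhite (proj₁ init)
    leftNeighbour-compatible (pt (suc a) b h) with b ≤? a
    ... | yes b≤a = hori (pt a b b≤a)
    ... | no  b≰a with ≤-antisym (recompute (b ≤? suc a) h) (≰⇒> b≰a)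
    ...   | refl = w₀-compatible-allWhite (diagonal-allWhite (suc a))

lemma5p4 : ∀ {nc N : ℕ} (white : Fin nc) (tiles : Fin N → Tile nc) →
    Injective _≡_ _≡_ tiles →
    AllWhiteIn white tiles →
    OtherWhiteBorder white tiles →
    ((I : Interp (HDom N) N) → IsHyperoctant white tiles I → Proper I →
       (ξ : Pt → Fin N) → Represents ξ I → Covers white tiles ξ)
    × ((ξ : Pt → Fin N) → Covers white tiles ξ →
       Σ[ I ∈ Interp (HDom N) N ] (IsHyperoctant white tiles I × Proper I × Represents ξ I))
lemma5p4 white tiles injective all-white-in other-white-border =
    (λ I hyp proper ξ rep → proper-hyperoctant-covers {tiles = tiles} hyp proper rep)
  , λ { ξ (init , verti , hori) →
        let open BorderSystem {white = white} {tiles = tiles} injective all-white-in other-white-border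
            open Cover init verti hori
        in  hyperoctantWith ξ leftNeighbour
          , hyperoctantWith-isHyperoctant ξ leftNeighbour {tiles = tiles} init verti leftNeighbour-compatible
          , hyperoctantWith-proper ξ leftNeighbour leftNeighbour-right
          , hyperoctantWith-represents ξ leftNeighbour }
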